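{- Let $S = S_1 \bowtie_{{\tt H},{\tt K}} S_2$ be the composition of communicating systems $S_1=(M^1_\mathtt{p})_{\mathtt{p}\in\mathbf{P}_1}$ and $S_2=(M^2_\mathtt{p})_{\mathtt{p}\in\mathbf{P}_2}$ (with $\mathbf{P}_1\cap\mathbf{P}_2=\emptyset$) with respect to roles ${\tt H}\in\mathbf{P}_1$, ${\tt K}\in\mathbf{P}_2$ such that $M^1_{\tt H}\leftrightarrow M^2_{\tt K}$. Let $s=(\vec q,\vec w)\in RS(S)$. Then: (i) if $q_{\tt H}\notin\widehat{Q_{\tt H}}$, then $s|_1\in RS(S_1)$; (ii) if $q_{\tt K}\notin\widehat{Q_{\tt K}}$, then $s|_2\in RS(S_2)$.
   Context: A CFSM over finite sets $\mathbf{P}$ of roles and $\mathbb{A}$ of messages is $M=(Q,q_0,\mathbb{A},\delta)$ with $Q$ finite, $q_0\in Q$, $\delta\subseteq Q\times Act\times Q$, where $Act=C_\mathbf{P}\times\{!,?\}\times\mathbb{A}$ and $C_\mathbf{P}=\{\mathtt{p}\mathtt{q}\mid \mathtt{p},\mathtt{q}\in\mathbf{P},\mathtt{p}\neq\mathtt{q}\}$ is the set of channels. Label $\mathtt{s}\mathtt{r}!a$ means $\mathtt{s}$ sends $a$ on channel $\mathtt{s}\mathtt{r}$; $\mathtt{s}\mathtt{r}?a$ means $\mathtt{r}$ consumes $a$ from channel $\mathtt{s}\mathtt{r}$. $\mathcal{L}(M)\subseteq Act^*$ is the language of $M$ with all states accepting. A state is final if it has no outgoing transition, sending (resp. receiving)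 if all its outgoing transitions are labelled by sending (resp. receiving) actions, mixed otherwise. $M$ is ?-deterministic if for every state $q$, $(q,\mathtt{r}\mathtt{s}?a,q'),(q,\mathtt{p}\mathtt{q}?a,q'')\in\delta$ imply $q'=q''$ (same message $a$, any channels); !-deterministic analogously for sends; ?!-deterministic if both. A communicating system over $\mathbf{P},\mathbb{A}$ is $S=(M_\mathtt{p})_{\mathtt{p}\in\mathbf{P}}$ with $M_\mathtt{p}=(Q_\mathtt{p},q_{0\mathtt{p}},\mathbb{A},\delta_\mathtt{p})$ CFSMs over $\mathbf{P},\mathbb{A}$. A configuration is $s=(\vec q,\vec w)$ with $\vec q=(q_\mathtt{p})_{\mathtt{p}\in\mathbf{P}}$, $q_\mathtt{p}\in Q_\mathtt{p}$, and $\vec w=(w_{\mathtt{p}\mathtt{q}})_{\mathtt{p}\mathtt{q}\in C_\mathbf{P}}$, $w_{\mathtt{p}\mathtt{q}}\in\mathbb{A}^*$; the initial configuration has all initial states and all channels empty. $s\to s'$ via $\mathtt{s}\mathtt{r}!a$ if $(q_\mathtt{s},\mathtt{s}\mathtt{r}!a,q'_\mathtt{s})\in\delta_\mathtt{s}$, all other local states unchanged, $w'_{\mathtt{s}\mathtt{r}}=w_{\mathtt{s}\mathtt{r}}\cdot a$, other channels unchanged; via $\mathtt{s}\mathtt{r}?a$ if $(q_\mathtt{r},\mathtt{s}\mathtt{r}?a,q'_\mathtt{r})\in\delta_\mathtt{r}$, other local states unchanged, $w_{\mathtt{s}\mathtt{r}}=a\cdot w'_{\mathtt{s}\mathtt{r}}$,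 other channels unchanged. $RS(S)$ is the set of configurations reachable from the initial one. For $\varphi\in Act^*$, $\varphi^{\not C}\in(\{!,?\}\times\mathbb{A})^*$ erases channel names ($(\mathtt{p}\mathtt{q}?a\cdot\varphi)^{\not C}=?a\cdot\varphi^{\not C}$, similarly for $!$), extended to sets; the dual $\overline{\cdot}$ swaps $!a$ and $?a$, extended to words and sets. CFSMs $M,M'$ are compatible, $M\leftrightarrow M'$, if $\mathcal{L}(M)^{\not C}=\overline{\mathcal{L}(M')^{\not C}}$, neither has mixed states, and both are ?!-deterministic. Gateway: for a CFSM $M_{\tt H}=(Q,q_0,\mathbb{A},\delta)$ of role ${\tt H}$ and a role ${\tt K}$, $\mathrm{gw}(M_{\tt H},{\tt K})=(Q\cup\widehat{Q},q_0,\mathbb{A},\delta')$ where $\widehat Q$ contains one fresh state $q^{t}$ for each transition $t=(q,l,q')\in\delta$, and $\delta'$ consists of: for each $t=(q,{\tt H}\mathtt{s}!a,q')\in\delta$, the transitions $(q,{\tt K}{\tt H}?a,q^{t})$ and $(q^{t},{\tt H}\mathtt{s}!a,q')$; for each $t=(q,\mathtt{s}{\tt H}?a,q')\in\delta$, the transitions $(q,\mathtt{s}{\tt H}?a,q^{t})$ and $(q^{t},{\tt H}{\tt K}!a,q')$. Composition: for systems $S_1$ over $\mathbf{P}_1,\mathbb{A}_1$ and $S_2$ over $\mathbf{P}_2,\mathbb{A}_2$ with $\mathbf{P}_1\cap\mathbf{P}_2=\emptyset$, ${\tt H}\in\mathbf{P}_1$, ${\tt K}\in\mathbf{P}_2$,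 $M^1_{\tt H}\leftrightarrow M^2_{\tt K}$, $S_1\bowtie_{{\tt H},{\tt K}}S_2=(M_\mathtt{p})_{\mathtt{p}\in\mathbf{P}_1\cup\mathbf{P}_2}$ over $\mathbf{P}_1\cup\mathbf{P}_2$ and $\mathbb{A}_1\cup\mathbb{A}_2$, where $M_{\tt H}=\mathrm{gw}(M^1_{\tt H},{\tt K})$, $M_{\tt K}=\mathrm{gw}(M^2_{\tt K},{\tt H})$, and $M_\mathtt{p}=M^i_\mathtt{p}$ for the other $\mathtt{p}\in\mathbf{P}_i$. $\widehat{Q_{\tt H}}$ (resp. $\widehat{Q_{\tt K}}$) denotes the set of fresh states added by the gateway construction to $M_{\tt H}$ (resp. $M_{\tt K}$). For a configuration $s=(\vec q,\vec w)$ of $S$, $s|_i=((q_\mathtt{p})_{\mathtt{p}\in\mathbf{P}_i},(w_{\mathtt{p}\mathtt{q}})_{\mathtt{p}\mathtt{q}\in C_{\mathbf{P}_i}})$. -}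

module Defs where

open import Data.Nat using (ℕ)
open import Data.Fin using (Fin; _≟_)
open import Data.List using (List; []; _∷_; _∷ʳ_; map)
open import Data.Product using (Σ; ∃; _×_; _,_; Σ-syntax; ∃-syntax)
open import Data.Sum using (_⊎_; inj₁; inj₂)
open import Data.Sum.Properties using (inj₁-injective; inj₂-injective)
open import Data.Empty using (⊥)
open import Data.Unit using (⊤)
open import Relation.Nullary using (¬_; Dec; yes; no)
open import Relation.Binary.PropositionalEquality using (_≡_; _≢_; refl; sym)
open import Function.Bundles using (_↔_; _⇔_)

-- Channels are pairs of distinct roles (p ≢ q).
--   snd p q _ a  is  "pq!a"   (p sends a on channel pq)
--   rcv p q _ a  is  "pq?a"   (q consumes a from channel pq)

data Act (R A : Set) : Set where
  snd : (p q : R) → p ≢ q → A → Act R A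
  rcv : (p q : R) → p ≢ q → A → Act R A

record CFSM (R A : Set) : Set₁ where
  field
    Q  : Set
    q₀ : Q
    δ  : Q → Act R A → Q → Set
open CFSM public

Finite : Set → Set
Finite X = Σ ℕ λ k → X ↔ Fin k

-- Language (all states accepting): words labelling a path from q₀.

data Run {R A : Set} (M : CFSM R A) : Q M → List (Act R A) → Set where
  done : ∀ {q} → Run M q []
  next : ∀ {q l q' φ} → δ M q l q' → Run M q' φ → Run M q (l ∷ φ)

InLang : {R A : Set} → CFSM R A → List (Act R A) → Set
InLang M φ = Run M (q₀ M) φ

data EAct (A : Set) : Set where
  out : A → EAct A
  inp : A → EAct A

erase : {R A : Set} → Act R A → EAct A
erase (snd _ _ _ a) = out a
erase (rcv _ _ _ a) = inp a

dualE : {A : Set} → EAct A → EAct A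
dualE (out a) = inp a
dualE (inp a) = out a

InErasedLang : {R A : Set} → CFSM R A → List (EAct A) → Set
InErasedLang M u = ∃[ φ ] (InLang M φ × map erase φ ≡ u)

InDualErasedLang : {R A : Set} → CFSM R A → List (EAct A) → Set
InDualErasedLang M u = ∃[ v ] (InErasedLang M v × map dualE v ≡ u)

HasSendOut : {R A : Set} (M : CFSM R A) → Q M → Set
HasSendOut M q = ∃[ p ] ∃[ r ] Σ[ pr ∈ p ≢ r ] ∃[ a ] ∃[ q' ] δ M q (snd p r pr a) q'

HasRecvOut : {R A : Set} (M : CFSM R A) → Q M → Set
HasRecvOut M q = ∃[ p ] ∃[ r ] Σ[ pr ∈ p ≢ r ] ∃[ a ] ∃[ q' ] δ M q (rcv p r pr a) q'

NoMixed : {R A : Set} → CFSM R A → Set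
NoMixed M = ∀ q → ¬ (HasSendOut M q × HasRecvOut M q)

RecvDet : {R A : Set} → CFSM R A → Set
RecvDet M = ∀ q r s (rs : r ≢ s) p p' (pp' : p ≢ p') a q₁ q₂ →
  δ M q (rcv r s rs a) q₁ → δ M q (rcv p p' pp' a) q₂ → q₁ ≡ q₂

SendDet : {R A : Set} → CFSM R A → Set
SendDet M = ∀ q r s (rs : r ≢ s) p p' (pp' : p ≢ p') a q₁ q₂ →
  δ M q (snd r s rs a) q₁ → δ M q (snd p p' pp' a) q₂ → q₁ ≡ q₂

RecvSendDet : {R A : Set} → CFSM R A → Set
RecvSendDet M = RecvDet M × SendDet M

Compatible : {R R' A : Set} → CFSM R A → CFSM R' A → Set
Compatible M M' =
  (∀ u → InErasedLang M u ⇔ InDualErasedLang M' u)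
  × NoMixed M × NoMixed M' × RecvSendDet M × RecvSendDet M'

System : Set → Set → Set₁
System R A = R → CFSM R A

record Config {R A : Set} (S : System R A) : Set where
  field
    st  : (p : R) → Q (S p)
    buf : (p q : R) → p ≢ q → List A
open Config public

data Step {R A : Set} (S : System R A) (c : Config S) : Act R A → Config S → Set where
  send : ∀ {s r} (sr : s ≢ r) {a} {c' : Config S} →
    δ (S s) (st c s) (snd s r sr a) (st c' s) →
    (∀ p → p ≢ s → st c' p ≡ st c p) →
    (∀ sr' → buf c' s r sr' ≡ buf c s r sr' ∷ʳ a) →
    (∀ p q (pq : p ≢ q) → ¬ (p ≡ s × q ≡ r) → buf c' p q pq ≡ buf c p q pq) →
    Step S c (snd s r sr a) c'
  recv : ∀ {s r} (sr : s ≢ r) {a} {c' : Config S} →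
    δ (S r) (st c r) (rcv s r sr a) (st c' r) →
    (∀ p → p ≢ r → st c' p ≡ st c p) →
    (∀ sr' → buf c s r sr' ≡ a ∷ buf c' s r sr') →
    (∀ p q (pq : p ≢ q) → ¬ (p ≡ s × q ≡ r) → buf c' p q pq ≡ buf c p q pq) →
    Step S c (rcv s r sr a) c'

data Reachable {R A : Set} (S : System R A) : Config S → Set where
  init : ∀ {c} → (∀ p → st c p ≡ q₀ (S p)) → (∀ p q (pq : p ≢ q) → buf c p q pq ≡ []) →
         Reachable S c
  step : ∀ {c l c'} → Reachable S c → Step S c l c' → Reachable S c'

module Embed (A : Set) {R R' : Set} (ι : R → R') (ι-inj : ∀ {x y} → ι x ≡ ι y → x ≡ y) where

  ι≢ : ∀ {x y} → x ≢ y → ι x ≢ ι y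
  ι≢ ne e = ne (ι-inj e)

  liftAct : Act R A → Act R' A
  liftAct (snd p q pq a) = snd (ι p) (ι q) (ι≢ pq) a
  liftAct (rcv p q pq a) = rcv (ι p) (ι q) (ι≢ pq) a

  data LiftΔ (M : CFSM R A) : Q M → Act R' A → Q M → Set where
    lift : ∀ {q l q'} → δ M q l q' → LiftΔ M q (liftAct l) q'

  liftM : CFSM R A → CFSM R' A
  liftM M = record { Q = Q M ; q₀ = q₀ M ; δ = LiftΔ M }

  Trans : CFSM R A → Set
  Trans M = Σ[ q ∈ Q M ] Σ[ l ∈ Act R A ] Σ[ q' ∈ Q M ] δ M q l q'

  -- Q ∪ Q̂ : old states, and one fresh state q^t per transition t
  data GwState (M : CFSM R A) : Set where
    old   : Q M → GwState M
    fresh : Trans M → GwState M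

  data GwΔ (M : CFSM R A) (H : R) (K : R') (KH : K ≢ ι H) :
           GwState M → Act R' A → GwState M → Set where
    out₁ : ∀ {q s} {hs : H ≢ s} {a q'} (t : δ M q (snd H s hs a) q') →
      GwΔ M H K KH (old q) (rcv K (ι H) KH a) (fresh (q , snd H s hs a , q' , t))
    out₂ : ∀ {q s} {hs : H ≢ s} {a q'} (t : δ M q (snd H s hs a) q') →
      GwΔ M H K KH (fresh (q , snd H s hs a , q' , t)) (liftAct (snd H s hs a)) (old q')
    in₁ : ∀ {q s} {sh : s ≢ H} {a q'} (t : δ M q (rcv s H sh a) q') →
      GwΔ M H K KH (old q) (liftAct (rcv s H sh a)) (fresh (q , rcv s H sh a , q' , t))
    in₂ : ∀ {q s} {sh : s ≢ H} {a q'} (t : δ M q (rcv s H sh a) q') →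
      GwΔ M H K KH (fresh (q , rcv s H sh a , q' , t)) (snd (ι H) K (λ e → KH (sym e)) a) (old q')

  gw : (M : CFSM R A) (H : R) (K : R') → K ≢ ι H → CFSM R' A
  gw M H K KH = record { Q = GwState M ; q₀ = old (q₀ M) ; δ = GwΔ M H K KH }

-- Composition S₁ ⋈_{H,K} S₂ ; roles P₁ = Fin n₁, P₂ = Fin n₂ (disjoint via ⊎),
-- messages: a common finite alphabet Fin m containing 𝔸₁ ∪ 𝔸₂.

module Composition {n₁ n₂ m : ℕ} (S₁ : System (Fin n₁) (Fin m)) (S₂ : System (Fin n₂) (Fin m))
                   (H : Fin n₁) (K : Fin n₂) where

  P : Set
  P = Fin n₁ ⊎ Fin n₂

  module E₁ = Embed (Fin m) {Fin n₁} {P} inj₁ inj₁-injective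
  module E₂ = Embed (Fin m) {Fin n₂} {P} inj₂ inj₂-injective

  comp₁ : (p : Fin n₁) → Dec (p ≡ H) → CFSM P (Fin m)
  comp₁ p (yes _) = E₁.gw (S₁ p) p (inj₂ K) (λ ())
  comp₁ p (no _)  = E₁.liftM (S₁ p)

  comp₂ : (p : Fin n₂) → Dec (p ≡ K) → CFSM P (Fin m)
  comp₂ p (yes _) = E₂.gw (S₂ p) p (inj₁ H) (λ ())
  comp₂ p (no _)  = E₂.liftM (S₂ p)

  compose : System P (Fin m)
  compose (inj₁ p) = comp₁ p (p ≟ H)
  compose (inj₂ p) = comp₂ p (p ≟ K)

  fresh₁ : (p : Fin n₁) (d : Dec (p ≡ H)) → Q (comp₁ p d) → Set
  fresh₁ p (yes _) (E₁.old _)   = ⊥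
  fresh₁ p (yes _) (E₁.fresh _) = ⊤
  fresh₁ p (no _)  _            = ⊥

  fresh₂ : (p : Fin n₂) (d : Dec (p ≡ K)) → Q (comp₂ p d) → Set
  fresh₂ p (yes _) (E₂.old _)   = ⊥
  fresh₂ p (yes _) (E₂.fresh _) = ⊤
  fresh₂ p (no _)  _            = ⊥

  InQ̂H : Q (compose (inj₁ H)) → Set
  InQ̂H = fresh₁ H (H ≟ H)

  InQ̂K : Q (compose (inj₂ K)) → Set
  InQ̂K = fresh₂ K (K ≟ K)

  -- local state of the composition equals (under Q ⊆ Q ∪ Q̂) a local state of S_i
  rel₁ : (p : Fin n₁) (d : Dec (p ≡ H)) → Q (comp₁ p d) → Q (S₁ p) → Set
  rel₁ p (yes _) q q' = q ≡ E₁.old q'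
  rel₁ p (no _)  q q' = q ≡ q'

  rel₂ : (p : Fin n₂) (d : Dec (p ≡ K)) → Q (comp₂ p d) → Q (S₂ p) → Set
  rel₂ p (yes _) q q' = q ≡ E₂.old q'
  rel₂ p (no _)  q q' = q ≡ q'

  Restricts₁ : Config compose → Config S₁ → Set
  Restricts₁ s c =
    (∀ p → rel₁ p (p ≟ H) (st s (inj₁ p)) (st c p))
    × (∀ p q (pq : p ≢ q) → buf s (inj₁ p) (inj₁ q) (E₁.ι≢ pq) ≡ buf c p q pq)

  Restricts₂ : Config compose → Config S₂ → Set
  Restricts₂ s c =
    (∀ p → rel₂ p (p ≟ K) (st s (inj₂ p)) (st c p))
    × (∀ p q (pq : p ≢ q) → buf s (inj₂ p) (inj₂ q) (E₂.ι≢ pq) ≡ buf c p q pq)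

  RestrictReachable₁ : Config compose → Set
  RestrictReachable₁ s = ∃[ c ] (Reachable S₁ c × Restricts₁ s c)

  RestrictReachable₂ : Config compose → Set
  RestrictReachable₂ s = ∃[ c ] (Reachable S₂ c × Restricts₂ s c)

module Submission where

-- The proof is a simulation argument between a system S over roles P and a
-- system T over roles R, done once for an arbitrary injective renaming
-- ι : R → P and then instantiated with ι = inj₁ (T = S₁) and ι = inj₂ (T = S₂).
--   * Every local transition of a role ι p of S is either a renamed transition
--     of the corresponding role p of T ("visible"), or leaves the abstract local
--     state unchanged and touches a channel with an endpoint outside the image
--     of ι ("silent").  Renamed machines simulate their originals with the
--     identity abstraction; a gateway gw(M,K) simulates M when its fresh state
--     q^t is abstracted to the source (for sends) or target (for receives) of t.
--   * Consequently every step of S maps to a step of T or to no change at all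
--     (steps of roles outside the image never touch channels among ι-roles), so
--     the abstraction of a reachable configuration of S is reachable in T.
--   * On a configuration whose gateway is in an old state, the abstraction is
--     exactly the restriction s|ᵢ.

open import Defs
open import Data.Nat using (ℕ)
open import Data.Fin using (Fin; _≟_)
open import Data.Sum using (inj₁; inj₂; _⊎_)
open import Data.Sum.Properties using (inj₁-injective; inj₂-injective)
open import Data.Product using (_×_; Σ-syntax; _,_)
open import Data.List using (_∷_)
open import Data.Empty using (⊥-elim)
open import Data.Unit using (tt)
open import Function using (id)
open import Relation.Nullary using (¬_; Dec; yes; no)
open import Relation.Binary.Definitions using (DecidableEquality)
open import Relation.Binary.PropositionalEquality
  using (_≡_; _≢_; refl; sym; trans; cong; subst)

src : ∀ {R A : Set} → Act R A → R
src (snd p _ _ _) = p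
src (rcv p _ _ _) = p

tgt : ∀ {R A : Set} → Act R A → R
tgt (snd _ q _ _) = q
tgt (rcv _ q _ _) = q

actor : ∀ {R A : Set} → Act R A → R
actor (snd p _ _ _) = p
actor (rcv _ q _ _) = q

module _ {R A : Set} {S : System R A} where

  step-local : ∀ {c l c'} → Step S c l c' →
               δ (S (actor l)) (st c (actor l)) l (st c' (actor l))
  step-local (send _ t _ _ _) = t
  step-local (recv _ t _ _ _) = t

  step-frame-st : ∀ {c l c'} → Step S c l c' → ∀ x → x ≢ actor l → st c' x ≡ st c x
  step-frame-st (send _ _ stEq _ _) = stEq
  step-frame-st (recv _ _ stEq _ _) = stEq

  step-frame-buf : ∀ {c l c'} → Step S c l c' →
                   ∀ p q (pq : p ≢ q) → ¬ (p ≡ src l × q ≡ tgt l) → buf c' p q pq ≡ buf c p q pq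
  step-frame-buf (send _ _ _ _ bufO) = bufO
  step-frame-buf (recv _ _ _ _ bufO) = bufO

  _≈_ : Config S → Config S → Set
  c ≈ c' = (∀ p → st c p ≡ st c' p) × (∀ p q pq → buf c p q pq ≡ buf c' p q pq)

  Step-resp-≈ : ∀ {c l c' c''} → Step S c l c' → c' ≈ c'' → Step S c l c''
  Step-resp-≈ {c} (send {s} sr t stEq bufEq bufO) (es , eb) =
    send sr (subst (δ (S s) (st c s) _) (es s) t)
         (λ p ne → trans (sym (es p)) (stEq p ne))
         (λ sr' → trans (sym (eb _ _ sr')) (bufEq sr'))
         (λ p q pq ne → trans (sym (eb p q pq)) (bufO p q pq ne))
  Step-resp-≈ {c} (recv {r = r} sr t stEq bufEq bufO) (es , eb) =
    recv sr (subst (δ (S r) (st c r) _) (es r) t)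
         (λ p ne → trans (sym (es p)) (stEq p ne))
         (λ sr' → trans (bufEq sr') (cong (_ ∷_) (eb _ _ sr')))
         (λ p q pq ne → trans (sym (eb p q pq)) (bufO p q pq ne))

  Reachable-resp-≈ : ∀ {c c'} → Reachable S c → c ≈ c' → Reachable S c'
  Reachable-resp-≈ (init h b) (es , eb) =
    init (λ p → trans (sym (es p)) (h p)) (λ p q pq → trans (sym (eb p q pq)) (b p q pq))
  Reachable-resp-≈ (step r s) e = step r (Step-resp-≈ s e)

module Projection (A : Set) {R P : Set} (ι : R → P) (ι-inj : ∀ {x y} → ι x ≡ ι y → x ≡ y) where
  open Embed A ι ι-inj

  actor-liftAct : ∀ l → actor (liftAct l) ≡ ι (actor l)
  actor-liftAct (snd _ _ _ _) = refl
  actor-liftAct (rcv _ _ _ _) = refl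

  External : Act P A → Set
  External l = (∀ p → ι p ≢ src l) ⊎ (∀ p → ι p ≢ tgt l)

  -- A role outside the image of ι only acts on channels to or from itself.
  outside-actor-external : ∀ l → (∀ p → ι p ≢ actor l) → External l
  outside-actor-external (snd _ _ _ _) outside = inj₁ outside
  outside-actor-external (rcv _ _ _ _) outside = inj₂ outside

  data LocalStep (M' : CFSM P A) (M : CFSM R A) (abs : Q M' → Q M)
                 (x : Q M') (l : Act P A) (y : Q M') : Set where
    visible : ∀ {l₁} → liftAct l₁ ≡ l → δ M (abs x) l₁ (abs y) → LocalStep M' M abs x l y
    silent  : abs y ≡ abs x → External l → LocalStep M' M abs x l y

  Simulates : (M' : CFSM P A) (M : CFSM R A) → (Q M' → Q M) → Set
  Simulates M' M abs = ∀ {x l y} → δ M' x l y → LocalStep M' M abs x l y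

  liftM-simulates : (M : CFSM R A) → Simulates (liftM M) M id
  liftM-simulates M (lift t) = visible refl t

  -- A fresh gateway state q^t for t = (q, l, q') stands for q if l is a send
  -- (not yet forwarded) and for q' if l is a receive (already consumed).
  gw-abs : {M : CFSM R A} → GwState M → Q M
  gw-abs (old q) = q
  gw-abs (fresh (q , snd _ _ _ _ , _ , _)) = q
  gw-abs (fresh (_ , rcv _ _ _ _ , q' , _)) = q'

  -- The gateway's extra actions use the outside partner K, hence are silent.
  gw-simulates : (M : CFSM R A) (H : R) (K : P) (KH : K ≢ ι H) →
                 (∀ r → ι r ≢ K) → Simulates (gw M H K KH) M gw-abs
  gw-simulates M H K KH K-out (out₁ t) = silent refl (inj₁ K-out)
  gw-simulates M H K KH K-out (out₂ t) = visible refl t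
  gw-simulates M H K KH K-out (in₁ t)  = visible refl t
  gw-simulates M H K KH K-out (in₂ t)  = silent refl (inj₂ K-out)

  module Simulation (S : System P A) (T : System R A)
           (abs : ∀ p → Q (S (ι p)) → Q (T p))
           (_≟ᴿ_ : DecidableEquality R)
           (classify : ∀ x → (Σ[ p ∈ R ] ι p ≡ x) ⊎ (∀ p → ι p ≢ x))
           (simulates : ∀ p → Simulates (S (ι p)) (T p) (abs p))
           (abs-init : ∀ p → abs p (q₀ (S (ι p))) ≡ q₀ (T p)) where

    α : Config S → Config T
    α c = record { st  = λ p → abs p (st c (ι p))
                 ; buf = λ p q pq → buf c (ι p) (ι q) (ι≢ pq) }

    α-frame-st : ∀ {c l c'} → Step S c l c' → ∀ p → ι p ≢ actor l → st (α c) p ≡ st (α c') p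
    α-frame-st stp p ne = sym (cong (abs p) (step-frame-st stp (ι p) ne))

    α-frame-buf : ∀ {c l c'} → Step S c l c' → External l →
                  ∀ p q pq → buf (α c) p q pq ≡ buf (α c') p q pq
    α-frame-buf stp (inj₁ outside) p q pq = sym (step-frame-buf stp _ _ _ (λ (e , _) → outside p e))
    α-frame-buf stp (inj₂ outside) p q pq = sym (step-frame-buf stp _ _ _ (λ (_ , e) → outside q e))

    α-lift-step : ∀ {c c' l₁} → Step S c (liftAct l₁) c' →
                  δ (T (actor l₁)) (st (α c) (actor l₁)) l₁ (st (α c') (actor l₁)) →
                  Step T (α c) l₁ (α c')
    α-lift-step {l₁ = snd p q pq a} stp@(send _ _ _ bufEq _) t =
      send pq t (λ p' ne → sym (α-frame-st stp p' (ι≢ ne))) (λ pq' → bufEq (ι≢ pq'))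
           (λ p' q' pq' ne → step-frame-buf stp _ _ _ (λ (e₁ , e₂) → ne (ι-inj e₁ , ι-inj e₂)))
    α-lift-step {l₁ = rcv p q pq a} stp@(recv _ _ _ bufEq _) t =
      recv pq t (λ q' ne → sym (α-frame-st stp q' (ι≢ ne))) (λ pq' → bufEq (ι≢ pq'))
           (λ p' q' pq' ne → step-frame-buf stp _ _ _ (λ (e₁ , e₂) → ne (ι-inj e₁ , ι-inj e₂)))

    actor-local-step : ∀ {c l c'} → Step S c l c' → ∀ p → ι p ≡ actor l →
                       LocalStep (S (ι p)) (T p) (abs p) (st c (ι p)) l (st c' (ι p))
    actor-local-step {c} {l} {c'} stp p e =
      simulates p (subst (λ x → δ (S x) (st c x) l (st c' x)) (sym e) (step-local stp))

    α-step : ∀ {c l c'} → Step S c l c' → (Σ[ l₁ ∈ Act R A ] Step T (α c) l₁ (α c')) ⊎ α c ≈ α c'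
    α-step {c} {l} {c'} stp with classify (actor l)
    ... | inj₂ outside =
      inj₂ ((λ p → α-frame-st stp p (outside p)) , α-frame-buf stp (outside-actor-external l outside))
    ... | inj₁ (p , e) with actor-local-step stp p e
    ...   | silent unchanged ext = inj₂ (states , α-frame-buf stp ext)
      where
        states : ∀ p' → st (α c) p' ≡ st (α c') p'
        states p' with p' ≟ᴿ p
        ... | yes refl = sym unchanged
        ... | no ne    = α-frame-st stp p' (λ e' → ne (ι-inj (trans e' (sym e))))
    ...   | visible {l₁} refl t = inj₁ (l₁ , α-lift-step stp (subst actorStep p≡actor t))
      where
        actorStep : R → Set
        actorStep q = δ (T q) (st (α c) q) l₁ (st (α c') q)
        p≡actor : p ≡ actor l₁
        p≡actor = ι-inj (trans e (actor-liftAct l₁))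

    α-reachable : ∀ {c} → Reachable S c → Reachable T (α c)
    α-reachable (init h b) =
      init (λ p → trans (cong (abs p) (h (ι p))) (abs-init p)) (λ p q pq → b _ _ _)
    α-reachable (step r stp) with α-step stp
    ... | inj₁ (_ , stp₁) = step (α-reachable r) stp₁
    ... | inj₂ eq         = Reachable-resp-≈ (α-reachable r) eq

module _ {n₁ n₂ m : ℕ} (S₁ : System (Fin n₁) (Fin m)) (S₂ : System (Fin n₂) (Fin m))
         (H : Fin n₁) (K : Fin n₂) where
  open Composition S₁ S₂ H K
  module Π₁ = Projection (Fin m) {Fin n₁} {P} inj₁ inj₁-injective
  module Π₂ = Projection (Fin m) {Fin n₂} {P} inj₂ inj₂-injective

  abs₁ : ∀ p d → Q (comp₁ p d) → Q (S₁ p)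
  abs₁ p (yes _) = Π₁.gw-abs
  abs₁ p (no _)  = id

  abs₂ : ∀ p d → Q (comp₂ p d) → Q (S₂ p)
  abs₂ p (yes _) = Π₂.gw-abs
  abs₂ p (no _)  = id

  -- Each component of S simulates the corresponding one of S₁ (resp. S₂):
  -- the gateway because its partner lives on the other side of the sum.
  simulates₁ : ∀ p d → Π₁.Simulates (comp₁ p d) (S₁ p) (abs₁ p d)
  simulates₁ p (yes _) = Π₁.gw-simulates (S₁ p) p (inj₂ K) (λ ()) (λ _ ())
  simulates₁ p (no _)  = Π₁.liftM-simulates (S₁ p)

  simulates₂ : ∀ p d → Π₂.Simulates (comp₂ p d) (S₂ p) (abs₂ p d)
  simulates₂ p (yes _) = Π₂.gw-simulates (S₂ p) p (inj₁ H) (λ ()) (λ _ ())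
  simulates₂ p (no _)  = Π₂.liftM-simulates (S₂ p)

  abs-init₁ : ∀ p d → abs₁ p d (q₀ (comp₁ p d)) ≡ q₀ (S₁ p)
  abs-init₁ p (yes _) = refl
  abs-init₁ p (no _)  = refl

  abs-init₂ : ∀ p d → abs₂ p d (q₀ (comp₂ p d)) ≡ q₀ (S₂ p)
  abs-init₂ p (yes _) = refl
  abs-init₂ p (no _)  = refl

  classify₁ : ∀ (x : P) → (Σ[ p ∈ Fin n₁ ] inj₁ p ≡ x) ⊎ (∀ p → inj₁ p ≢ x)
  classify₁ (inj₁ p) = inj₁ (p , refl)
  classify₁ (inj₂ _) = inj₂ (λ _ ())

  classify₂ : ∀ (x : P) → (Σ[ p ∈ Fin n₂ ] inj₂ p ≡ x) ⊎ (∀ p → inj₂ p ≢ x)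
  classify₂ (inj₁ _) = inj₂ (λ _ ())
  classify₂ (inj₂ p) = inj₁ (p , refl)

  module Sim₁ = Π₁.Simulation compose S₁ (λ p → abs₁ p (p ≟ H)) _≟_ classify₁
                 (λ p → simulates₁ p (p ≟ H)) (λ p → abs-init₁ p (p ≟ H))
  module Sim₂ = Π₂.Simulation compose S₂ (λ p → abs₂ p (p ≟ K)) _≟_ classify₂
                 (λ p → simulates₂ p (p ≟ K)) (λ p → abs-init₂ p (p ≟ K))

  abs-old₁ : ∀ p d x → ¬ fresh₁ p d x → rel₁ p d x (abs₁ p d x)
  abs-old₁ p (yes _) (E₁.old _)   _  = refl
  abs-old₁ p (yes _) (E₁.fresh _) nf = ⊥-elim (nf tt)
  abs-old₁ p (no _)  _            _  = refl

  abs-old₂ : ∀ p d x → ¬ fresh₂ p d x → rel₂ p d x (abs₂ p d x)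
  abs-old₂ p (yes _) (E₂.old _)   _  = refl
  abs-old₂ p (yes _) (E₂.fresh _) nf = ⊥-elim (nf tt)
  abs-old₂ p (no _)  _            _  = refl

  -- Only the gateway has fresh states, so "H not fresh" covers all of S₁'s roles.
  non-gateway-not-fresh₁ : ∀ p d x → p ≢ H → ¬ fresh₁ p d x
  non-gateway-not-fresh₁ p (yes e) _ ne = λ _ → ne e
  non-gateway-not-fresh₁ p (no _)  _ _  = λ ()

  not-fresh₁ : ∀ (s : Config compose) → ¬ InQ̂H (st s (inj₁ H)) →
               ∀ p → Dec (p ≡ H) → ¬ fresh₁ p (p ≟ H) (st s (inj₁ p))
  not-fresh₁ s nf p (yes refl) = nf
  not-fresh₁ s nf p (no ne)    = non-gateway-not-fresh₁ p (p ≟ H) _ ne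

  non-gateway-not-fresh₂ : ∀ p d x → p ≢ K → ¬ fresh₂ p d x
  non-gateway-not-fresh₂ p (yes e) _ ne = λ _ → ne e
  non-gateway-not-fresh₂ p (no _)  _ _  = λ ()

  not-fresh₂ : ∀ (s : Config compose) → ¬ InQ̂K (st s (inj₂ K)) →
               ∀ p → Dec (p ≡ K) → ¬ fresh₂ p (p ≟ K) (st s (inj₂ p))
  not-fresh₂ s nf p (yes refl) = nf
  not-fresh₂ s nf p (no ne)    = non-gateway-not-fresh₂ p (p ≟ K) _ ne

  restrict₁ : ∀ s → Reachable compose s → ¬ InQ̂H (st s (inj₁ H)) → RestrictReachable₁ s
  restrict₁ s r nf =
    Sim₁.α s , Sim₁.α-reachable r ,
    (λ p → abs-old₁ p (p ≟ H) (st s (inj₁ p)) (not-fresh₁ s nf p (p ≟ H))) , (λ _ _ _ → refl)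

  restrict₂ : ∀ s → Reachable compose s → ¬ InQ̂K (st s (inj₂ K)) → RestrictReachable₂ s
  restrict₂ s r nf =
    Sim₂.α s , Sim₂.α-reachable r ,
    (λ p → abs-old₂ p (p ≟ K) (st s (inj₂ p)) (not-fresh₂ s nf p (p ≟ K))) , (λ _ _ _ → refl)

lemma1 : ∀ {n₁ n₂ m : ℕ}
    (S₁ : System (Fin n₁) (Fin m)) (S₂ : System (Fin n₂) (Fin m))
    (H : Fin n₁) (K : Fin n₂) →
    (∀ p → Finite (Q (S₁ p))) → (∀ p → Finite (Q (S₂ p))) →
    Compatible (S₁ H) (S₂ K) →
    (s : Config (Composition.compose S₁ S₂ H K)) →
    Reachable (Composition.compose S₁ S₂ H K) s →
    ((¬ Composition.InQ̂H S₁ S₂ H K (st s (inj₁ H))) → Composition.RestrictReachable₁ S₁ S₂ H K s)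
    × ((¬ Composition.InQ̂K S₁ S₂ H K (st s (inj₂ K))) → Composition.RestrictReachable₂ S₁ S₂ H K s)
lemma1 S₁ S₂ H K _ _ _ s r = restrict₁ S₁ S₂ H K s r , restrict₂ S₁ S₂ H K s r
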